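{- Let $H$ be a directed graph with source $s$ and sink $t$ whose edge set is a minimal $(k+1)$-flow, i.e., consists of $k+1$ edge-disjoint $s$-$t$ paths. Let $\Gamma_H$ be the undirected graph whose vertices are the edges of $H$, with two edges $e,e'$ adjacent iff there is a minimum $s$-$t$ cut of $H$ containing both. Then a set $E'$ of edges of $H$ contains $k$ edge-disjoint $s$-$t$ paths if and only if $E'$ is a vertex cover of $\Gamma_H$; that is, the set system whose agents are the edges of $H$ and whose feasible sets are the $k$-flows in $H$ is the Vertex Cover set system of $\Gamma_H$.
   Context: A $k$-flow in $H$ is a set of edges containing $k$ edge-disjoint $s$-$t$ paths. -}

module Defs where

open import Data.Nat using (ℕ; _≤_)
open import Data.Fin using (Fin)
open import Data.Fin.Subset using (Subset; _∈_; _⊂_; ⊤; ∣_∣)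
open import Data.List using (List; []; _∷_; map)
open import Data.List.Relation.Unary.All using (All)
open import Data.List.Relation.Unary.Any using (Any)
open import Data.List.Relation.Unary.Unique.Propositional using (Unique)
import Data.List.Membership.Propositional as L
open import Data.Product using (Σ; _×_)
open import Data.Empty using (⊥)
open import Data.Sum using (_⊎_)
open import Relation.Binary.PropositionalEquality using (_≡_; _≢_)
open import Relation.Nullary using (¬_)

record Digraph : Set where
  field
    nV  : ℕ
    nE  : ℕ
    src : Fin nE → Fin nV
    tgt : Fin nE → Fin nV
open Digraph public

module _ (G : Digraph) where

  IsWalk : Fin (nV G) → Fin (nV G) → List (Fin (nE G)) → Set
  IsWalk u v []       = u ≡ v
  IsWalk u v (e ∷ es) = src G e ≡ u × IsWalk (tgt G e) v es

  IsPath : Fin (nV G) → Fin (nV G) → List (Fin (nE G)) → Set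
  IsPath u v es = IsWalk u v es × Unique (u ∷ map (tgt G) es)

  IsFlow : Fin (nV G) → Fin (nV G) → ℕ → Subset (nE G) → Set
  IsFlow s t k F =
    Σ (Fin k → List (Fin (nE G))) λ P →
      (∀ i → IsPath s t (P i)) ×
      (∀ i → All (_∈ F) (P i)) ×
      (∀ i j → i ≢ j → ∀ e → e L.∈ P i → e L.∈ P j → ⊥)

  IsMinimalFlow : Fin (nV G) → Fin (nV G) → ℕ → Subset (nE G) → Set
  IsMinimalFlow s t k F =
    IsFlow s t k F × (∀ F' → F' ⊂ F → ¬ IsFlow s t k F')

  IsCut : Fin (nV G) → Fin (nV G) → Subset (nE G) → Set
  IsCut s t C = ∀ es → IsPath s t es → Any (_∈ C) es

  IsMinCut : Fin (nV G) → Fin (nV G) → Subset (nE G) → Set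
  IsMinCut s t C = IsCut s t C × (∀ C' → IsCut s t C' → ∣ C ∣ ≤ ∣ C' ∣)

  ΓAdj : Fin (nV G) → Fin (nV G) → Fin (nE G) → Fin (nE G) → Set
  ΓAdj s t e e' = e ≢ e' × Σ (Subset (nE G)) λ C → IsMinCut s t C × e ∈ C × e' ∈ C

VertexCover : {n : ℕ} → (Fin n → Fin n → Set) → Subset n → Set
VertexCover {n} Adj S = ∀ (x y : Fin n) → Adj x y → x ∈ S ⊎ y ∈ S

-- The proof uses flow conservation: an edge set F conserves supply σ against demand τ when
-- out-degree + τ = in-degree + σ at every vertex.  Deleting an a–b trail moves one unit of
-- supply from a to b, and a set conserving k units from s to t decomposes into k edge-
-- disjoint s–t paths.  For H = P₀ ∪ … ∪ Pₖ this shows: every edge lies on some Pᵢ, H is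
-- acyclic (deleting a cycle would leave a smaller (k+1)-flow), and the edges leaving a
-- predecessor-closed vertex set S ∋ s, S ∌ t form a minimum cut (each Pᵢ leaves S once).
-- (⇒) A minimum cut through two edges outside a k-flow E′ also contains an edge of E′ on
--     each of its k paths, so it would have more than k+1 edges.
-- (⇐) If E′ is a vertex cover, the edges outside E′ are pairwise comparable (otherwise the
--     edges leaving the ancestors of s, d₁, d₂ form a minimum cut through both), so one s–t
--     trail runs through all of them, and deleting it leaves a k-flow inside E′.

module Submission where

open import Defs
open import Data.Nat using (ℕ; zero; suc; _+_; _*_; _≤_; _<_; z≤n; s≤s)
open import Data.Nat.Properties using (≤-refl; ≤-trans; ≤-pred; n≤1+n; m≤n+m; 1+n≰n; +-comm; +-assoc; +-identityʳ; +-cancelʳ-≡; *-zeroʳ; module ≤-Reasoning)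
open import Data.Nat.Tactic.RingSolver using (solve-∀)
open import Data.Bool using (_∧_)
open import Data.Fin using (Fin; zero; suc; punchOut)
open import Data.Fin.Properties using (_≟_; any?; ¬Fin0; suc-injective; 0≢1+n; punchOut-injective)
open import Data.Fin.Subset using (Subset; inside; outside; _∈_; _∉_; _⊆_; _⊂_; ⊤; ⁅_⁆; _∩_; _-_; ∣_∣; Nonempty) renaming (⊥ to ∅)
open import Data.Fin.Subset.Properties using (_∈?_; nonempty?; ∈⊤; Empty-unique; ∣⊥∣≡0; ∩-zeroˡ; p─⊥≡p; p─q⊆p; x∈p∩q⁺; x∈p∩q⁻; x∈p∧x≢y⇒x∈p-y; x∈p⇒p-x⊂p; x∈p⇒∣p-x∣<∣p∣; p⊆q⇒∣p∣≤∣q∣; ∣p∩q∣≤∣p∣)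
open import Data.Vec.Base using ([]; _∷_; here; there; tabulate)
open import Data.Vec.Properties using ([]=⇒lookup; lookup⇒[]=; lookup∘tabulate)
open import Data.List using (List; []; _∷_; _++_; map; length; filter; allFin)
open import Data.List.Properties using (length-map; length-tabulate; filter-notAll)
open import Data.List.Relation.Unary.All using (All; []; _∷_)
import Data.List.Relation.Unary.All as All
open import Data.List.Relation.Unary.All.Properties using (¬Any⇒All¬; All¬⇒¬Any)
open import Data.List.Relation.Unary.Any using (Any; here; there)
import Data.List.Relation.Unary.Any as Any
open import Data.List.Relation.Unary.Unique.Propositional using (Unique; []; _∷_)
import Data.List.Relation.Unary.Unique.Propositional.Properties as Unique
import Data.List.Membership.Propositional as L
import Data.List.Membership.DecPropositional as DecL
open import Data.List.Membership.Propositional.Properties using (∈-map⁺; ∈-filter⁺; ∈-filter⁻; ∈-allFin; ∈-++⁺ʳ)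
open import Data.Product using (Σ; ∃; _×_; _,_; proj₁; proj₂)
open import Data.Sum using (_⊎_; inj₁; inj₂; [_,_]′)
open import Data.Empty using (⊥; ⊥-elim)
open import Function using (_∘_; id)
open import Function.Bundles using (_⇔_; mk⇔; Equivalence)
open import Function.Construct.Composition using (_⇔-∘_)
open import Function.Definitions using (Injective)
open import Relation.Binary.Definitions using (DecidableEquality)
open import Relation.Binary.PropositionalEquality using (_≡_; _≢_; refl; sym; trans; cong; cong₂; subst; subst₂; module ≡-Reasoning)
open import Relation.Nullary using (¬_; Dec; yes; no; does)
open import Relation.Nullary.Decidable using (dec-true; map′; ¬?; _×-dec_)
open import Relation.Unary using (Decidable)

open Equivalence using (to; from)

swap-last : ∀ x y z → x + y + z ≡ x + z + y
swap-last = solve-∀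

swap-inner : ∀ x y z → x + y + z ≡ x + (z + y)
swap-inner = solve-∀

-- A balance equation x + τ ≡ y + σ only depends on the difference σ − τ ...
rebalance : ∀ {x y σ τ σ′ τ′} → σ + τ′ ≡ σ′ + τ → x + τ ≡ y + σ → x + τ′ ≡ y + σ′
rebalance {x} {y} {σ} {τ} {σ′} {τ′} same balanced = +-cancelʳ-≡ τ (x + τ′) (y + σ′) (begin
  x + τ′ + τ    ≡⟨ swap-last x τ′ τ ⟩
  x + τ + τ′    ≡⟨ cong (_+ τ′) balanced ⟩
  y + σ + τ′    ≡⟨ +-assoc y σ τ′ ⟩
  y + (σ + τ′)  ≡⟨ cong (y +_) same ⟩
  y + (σ′ + τ)  ≡⟨ +-assoc y σ′ τ ⟨
  y + σ′ + τ    ∎)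
  where open ≡-Reasoning

balance-move : ∀ {x y σ τ} x′ a y′ c → x ≡ x′ + a → y ≡ y′ + c →
               (x + τ ≡ y + σ) ⇔ (x′ + (τ + a) ≡ y′ + (σ + c))
balance-move {σ = σ} {τ} x′ a y′ c refl refl = mk⇔
  (λ h → trans (sym (swap-inner x′ a τ)) (trans h (swap-inner y′ c σ)))
  (λ h → trans (swap-inner x′ a τ) (trans h (sym (swap-inner y′ c σ))))

[_] : ∀ {a} {A : Set a} → Dec A → ℕ
[ yes _ ] = 1
[ no _ ] = 0

⟦_⟧ : ∀ {n} {P : Fin n → Set} → Decidable P → Subset n
⟦ P? ⟧ = tabulate (λ x → does (P? x))

∈⟦⟧⁺ : ∀ {n} {P : Fin n → Set} (P? : Decidable P) {x} → P x → x ∈ ⟦ P? ⟧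
∈⟦⟧⁺ P? {x} px = lookup⇒[]= x _ (trans (lookup∘tabulate _ x) (dec-true (P? x) px))

∈⟦⟧⁻ : ∀ {n} {P : Fin n → Set} (P? : Decidable P) {x} → x ∈ ⟦ P? ⟧ → P x
∈⟦⟧⁻ P? {x} x∈ with P? x | trans (sym (lookup∘tabulate (λ y → does (P? y)) x)) ([]=⇒lookup x∈)
... | yes px | _ = px
... | no _ | ()

x∉p-x : ∀ {n} (p : Subset n) (x : Fin n) → x ∉ p - x
x∉p-x (_ ∷ p) zero ()
x∉p-x (_ ∷ p) (suc x) (there x∈) = x∉p-x p x x∈

∣∅∩q∣≡0 : ∀ {n} (q : Subset n) → ∣ ∅ ∩ q ∣ ≡ 0
∣∅∩q∣≡0 {n} q = trans (cong ∣_∣ (∩-zeroˡ q)) (∣⊥∣≡0 n)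

∣p∩q∣-remove : ∀ {n} (p q : Subset n) {x} → x ∈ p → ∣ p ∩ q ∣ ≡ ∣ (p - x) ∩ q ∣ + ∣ ⁅ x ⁆ ∩ q ∣
∣p∩q∣-remove (inside ∷ p) (outside ∷ q) here =
  sym (trans (cong₂ _+_ (cong (λ r → ∣ r ∩ q ∣) (p─⊥≡p p)) (∣∅∩q∣≡0 q)) (+-identityʳ _))
∣p∩q∣-remove (inside ∷ p) (inside ∷ q) here =
  sym (trans (cong₂ _+_ (cong (λ r → ∣ r ∩ q ∣) (p─⊥≡p p)) (cong suc (∣∅∩q∣≡0 q))) (+-comm _ 1))
∣p∩q∣-remove (c ∷ p) (b ∷ q) (there x∈p) with c ∧ b
... | inside = cong suc (∣p∩q∣-remove p q x∈p)
... | outside = ∣p∩q∣-remove p q x∈p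

∣⁅x⁆∩⟦P⟧∣ : ∀ {n} {P : Fin n → Set} (P? : Decidable P) x → ∣ ⁅ x ⁆ ∩ ⟦ P? ⟧ ∣ ≡ [ P? x ]
∣⁅x⁆∩⟦P⟧∣ P? zero with P? zero
... | yes _ = cong suc (∣∅∩q∣≡0 ⟦ P? ∘ suc ⟧)
... | no _ = ∣∅∩q∣≡0 ⟦ P? ∘ suc ⟧
∣⁅x⁆∩⟦P⟧∣ P? (suc x) = ∣⁅x⁆∩⟦P⟧∣ (P? ∘ suc) x

nonempty : ∀ {n} (p : Subset n) → 1 ≤ ∣ p ∣ → Nonempty p
nonempty {n} p size with nonempty? p
... | yes p≠∅ = p≠∅
... | no p=∅ with subst (1 ≤_) (trans (cong ∣_∣ (Empty-unique p=∅)) (∣⊥∣≡0 n)) size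
...   | ()

card-lower : ∀ {m n} (C : Subset n) (f : Fin m → Fin n) → Injective _≡_ _≡_ f → (∀ i → f i ∈ C) → m ≤ ∣ C ∣
card-lower {zero} C f inj f∈C = z≤n
card-lower {suc m} C f inj f∈C = ≤-trans (s≤s rest) (x∈p⇒∣p-x∣<∣p∣ (f∈C zero))
  where
    rest : m ≤ ∣ C - f zero ∣
    rest = card-lower (C - f zero) (f ∘ suc) (suc-injective ∘ inj)
             (λ i → x∈p∧x≢y⇒x∈p-y (f∈C (suc i)) (λ eq → 0≢1+n (sym (inj eq))))

card-upper : ∀ {m n} (C : Subset n) (g : ∀ x → x ∈ C → Fin m) →
             (∀ {x y} (x∈C : x ∈ C) (y∈C : y ∈ C) → g x x∈C ≡ g y y∈C → x ≡ y) → ∣ C ∣ ≤ m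
card-upper [] g inj = z≤n
card-upper (outside ∷ C) g inj =
  card-upper C (λ x x∈C → g (suc x) (there x∈C)) (λ x∈C y∈C eq → suc-injective (inj (there x∈C) (there y∈C) eq))
card-upper {zero} (inside ∷ C) g inj = ⊥-elim (¬Fin0 (g zero here))
card-upper {suc m} (inside ∷ C) g inj = s≤s (card-upper C g′ g′-injective)
  where
    apart : ∀ {x} (x∈C : x ∈ C) → g zero here ≢ g (suc x) (there x∈C)
    apart x∈C eq = 0≢1+n (inj here (there x∈C) eq)
    g′ : ∀ x → x ∈ C → Fin m
    g′ x x∈C = punchOut (apart x∈C)
    g′-injective : ∀ {x y} (x∈C : x ∈ C) (y∈C : y ∈ C) → g′ x x∈C ≡ g′ y y∈C → x ≡ y
    g′-injective x∈C y∈C eq =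
      suc-injective (inj (there x∈C) (there y∈C) (punchOut-injective (apart x∈C) (apart y∈C) eq))

unique-length : ∀ {a} {A : Set a} → DecidableEquality A → {xs ys : List A} →
                Unique xs → All (L._∈ ys) xs → length xs ≤ length ys
unique-length _≟ₐ_ {[]} _ _ = z≤n
unique-length _≟ₐ_ {x ∷ xs} {ys} (x∉xs ∷ unique) (x∈ys ∷ xs⊆ys) =
  ≤-trans (s≤s (unique-length _≟ₐ_ unique xs⊆ys-x)) (filter-notAll not-x ys (Any.map (λ x≡y y≢x → y≢x (sym x≡y)) x∈ys))
  where
    not-x : Decidable (λ y → ¬ y ≡ x)
    not-x y = ¬? (y ≟ₐ x)
    xs⊆ys-x : All (L._∈ filter not-x ys) xs
    xs⊆ys-x = All.zipWith (λ (y∈ys , x≢y) → ∈-filter⁺ not-x y∈ys (x≢y ∘ sym)) (xs⊆ys , x∉xs)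

_∖_ : ∀ {n} → Subset n → List (Fin n) → Subset n
F ∖ [] = F
F ∖ (e ∷ T) = (F - e) ∖ T

∖-⊆ : ∀ {n} {F : Subset n} T → F ∖ T ⊆ F
∖-⊆ [] x∈ = x∈
∖-⊆ {F = F} (e ∷ T) x∈ = p─q⊆p F ⁅ e ⁆ (∖-⊆ T x∈)

∖-∉ : ∀ {n} {F : Subset n} T {x} → x ∈ F ∖ T → ¬ x L.∈ T
∖-∉ {F = F} (e ∷ T) x∈ (here refl) = x∉p-x F e (∖-⊆ T x∈)
∖-∉ (e ∷ T) x∈ (there x∈T) = ∖-∉ T x∈ x∈T

∈-∖ : ∀ {n} {F : Subset n} T {x} → x ∈ F → ¬ x L.∈ T → x ∈ F ∖ T
∈-∖ [] x∈F _ = x∈F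
∈-∖ (e ∷ T) x∈F x∉T = ∈-∖ T (x∈p∧x≢y⇒x∈p-y x∈F (x∉T ∘ here)) (x∉T ∘ there)

module Walks (G : Digraph) where

  private
    V = Fin (nV G)
    E = Fin (nE G)
    module DecV = DecL (_≟_ {nV G})

  Reach : V → V → Set
  Reach u v = Σ (List E) (IsWalk G u v)

  walk-++ : ∀ {a b c} w₁ {w₂} → IsWalk G a b w₁ → IsWalk G b c w₂ → IsWalk G a c (w₁ ++ w₂)
  walk-++ [] refl walk₂ = walk₂
  walk-++ (e ∷ w₁) (src≡a , walk₁) walk₂ = src≡a , walk-++ w₁ walk₁ walk₂

  reach-trans : ∀ {a b c} → Reach a b → Reach b c → Reach a c
  reach-trans (w₁ , walk₁) (w₂ , walk₂) = w₁ ++ w₂ , walk-++ w₁ walk₁ walk₂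

  reach-edge : ∀ e {c} → Reach (tgt G e) c → Reach (src G e) c
  reach-edge e (w , walk) = e ∷ w , refl , walk

  walk-split : ∀ {a b e} w → IsWalk G a b w → e L.∈ w → Reach a (src G e) × Reach (tgt G e) b
  walk-split (_ ∷ w) (src≡a , walk) (here refl) = ([] , sym src≡a) , (w , walk)
  walk-split (e′ ∷ w) (src≡a , walk) (there e∈w) =
    let (w₁ , walk₁) , after = walk-split w walk e∈w in (e′ ∷ w₁ , src≡a , walk₁) , after

  path-edges-unique : ∀ {a b p} → IsPath G a b p → Unique p
  path-edges-unique (_ , _ ∷ distinct-heads) = Unique.map⁻ distinct-heads

  edge-path-unique : ∀ {e b p} → IsPath G (tgt G e) b p → Unique (e ∷ p)
  edge-path-unique {e} path@(_ , tgt∉ ∷ _) =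
    All.tabulate (λ e′∈p e≡e′ → All.lookup tgt∉ (∈-map⁺ (tgt G) e′∈p) (cong (tgt G) e≡e′)) ∷ path-edges-unique path

  path-suffix : ∀ {x b a} p → IsPath G x b p → a L.∈ x ∷ map (tgt G) p →
                Σ (List E) λ q → IsPath G a b q × All (L._∈ p) q
  path-suffix p path (here refl) = p , path , All.tabulate id
  path-suffix (e ∷ p) ((_ , walk) , _ ∷ distinct) (there a∈) =
    let q , path′ , q⊆p = path-suffix p (walk , distinct) a∈ in q , path′ , All.map there q⊆p

  shortcut : ∀ {a b} w → IsWalk G a b w → Σ (List E) λ p → IsPath G a b p × All (L._∈ w) p
  shortcut [] refl = [] , (refl , [] ∷ []) , []
  shortcut {a} (e ∷ w) (src≡a , walk) with shortcut w walk
  ... | p , path , p⊆w with a DecV.∈? tgt G e ∷ map (tgt G) p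
  ...   | yes a-on-p = let q , path′ , q⊆p = path-suffix p path a-on-p
                       in q , path′ , All.map (there ∘ All.lookup p⊆w) q⊆p
  ...   | no a-off-p = e ∷ p , ((src≡a , proj₁ path) , ¬Any⇒All¬ _ a-off-p ∷ proj₂ path) , here refl ∷ All.map there p⊆w

  path-length : ∀ {a b p} → IsPath G a b p → length p ≤ nV G
  path-length {p = p} (_ , distinct) =
    ≤-trans (n≤1+n _) (subst₂ _≤_ (cong suc (length-map (tgt G) p)) (length-tabulate id)
                                (unique-length _≟_ distinct (All.tabulate (λ {x} _ → ∈-allFin x))))

  ReachWithin : ℕ → V → V → Set
  ReachWithin n u v = Σ (List E) λ w → IsWalk G u v w × length w ≤ n

  reach-within? : ∀ n u v → Dec (ReachWithin n u v)
  reach-within? zero u v with u ≟ v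
  ... | yes u≡v = yes ([] , u≡v , z≤n)
  ... | no u≢v = no λ { ([] , u≡v , _) → u≢v u≡v ; (_ ∷ _ , _ , ()) }
  reach-within? (suc n) u v with u ≟ v
  ... | yes u≡v = yes ([] , u≡v , z≤n)
  ... | no u≢v with any? (λ e → (src G e ≟ u) ×-dec reach-within? n (tgt G e) v)
  ...   | yes (e , src≡u , w , walk , short) = yes (e ∷ w , (src≡u , walk) , s≤s short)
  ...   | no none = no λ { ([] , u≡v , _) → u≢v u≡v
                         ; (e ∷ w , (src≡u , walk) , s≤s short) → none (e , src≡u , w , walk , short) }

  -- Reachability is decidable: a shortest walk is a path, and paths are short.
  reach? : ∀ u v → Dec (Reach u v)
  reach? u v = map′ (λ (w , walk , _) → w , walk) within-bound (reach-within? (nV G) u v)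
    where
      within-bound : Reach u v → ReachWithin (nV G) u v
      within-bound (w , walk) = let p , path , _ = shortcut w walk in p , proj₁ path , path-length path

  ancestors : List V → Subset (nV G)
  ancestors Y = ⟦ (λ x → Any.any? (reach? x) Y) ⟧

  ancestors⁻ : ∀ Y {x} → x ∈ ancestors Y → Any (Reach x) Y
  ancestors⁻ Y = ∈⟦⟧⁻ (λ x → Any.any? (reach? x) Y)

  ancestors-⊇ : ∀ Y {y} → y L.∈ Y → y ∈ ancestors Y
  ancestors-⊇ Y y∈Y = ∈⟦⟧⁺ (λ x → Any.any? (reach? x) Y) (Any.map (λ y≡y′ → [] , y≡y′) y∈Y)

  ancestors-closed : ∀ Y e → tgt G e ∈ ancestors Y → src G e ∈ ancestors Y
  ancestors-closed Y e tgt∈ = ∈⟦⟧⁺ (λ x → Any.any? (reach? x) Y) (Any.map (reach-edge e) (ancestors⁻ Y tgt∈))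

-- Degrees, supplies and flow conservation.
module Conservation (G : Digraph) where

  private
    V = Fin (nV G)

  δ : V → V → ℕ
  δ u v = [ u ≟ v ]

  δ-refl : ∀ u → δ u u ≡ 1
  δ-refl u with u ≟ u
  ... | yes _ = refl
  ... | no u≢u = ⊥-elim (u≢u refl)

  δ-≢ : ∀ {u v} → u ≢ v → δ u v ≡ 0
  δ-≢ {u} {v} u≢v with u ≟ v
  ... | yes u≡v = ⊥-elim (u≢v u≡v)
  ... | no _ = refl

  outdeg indeg : Subset (nE G) → V → ℕ
  outdeg F v = ∣ F ∩ ⟦ (λ e → src G e ≟ v) ⟧ ∣
  indeg F v = ∣ F ∩ ⟦ (λ e → tgt G e ≟ v) ⟧ ∣

  outdeg-remove : ∀ {F e} → e ∈ F → ∀ v → outdeg F v ≡ outdeg (F - e) v + δ (src G e) v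
  outdeg-remove {F} {e} e∈F v =
    trans (∣p∩q∣-remove F _ e∈F) (cong (outdeg (F - e) v +_) (∣⁅x⁆∩⟦P⟧∣ (λ e → src G e ≟ v) e))

  indeg-remove : ∀ {F e} → e ∈ F → ∀ v → indeg F v ≡ indeg (F - e) v + δ (tgt G e) v
  indeg-remove {F} {e} e∈F v =
    trans (∣p∩q∣-remove F _ e∈F) (cong (indeg (F - e) v +_) (∣⁅x⁆∩⟦P⟧∣ (λ e → tgt G e ≟ v) e))

  leaving-edge : ∀ {F a} → 1 ≤ outdeg F a → ∃ λ e → e ∈ F × src G e ≡ a
  leaving-edge {F} {a} positive =
    let e , e∈ = nonempty (F ∩ _) positive
        e∈F , e-leaves = x∈p∩q⁻ F _ e∈
    in e , e∈F , ∈⟦⟧⁻ (λ e → src G e ≟ a) e-leaves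

  Supply : Set
  Supply = V → ℕ

  _⊕_ : Supply → V → Supply
  (σ ⊕ u) v = σ v + δ u v

  record Conserves (F : Subset (nE G)) (σ τ : Supply) : Set where
    constructor conserving
    field balance : ∀ v → outdeg F v + τ v ≡ indeg F v + σ v

  conserves-⇔ : ∀ {F F′ σ τ σ′ τ′} →
                (∀ v → (outdeg F v + τ v ≡ indeg F v + σ v) ⇔ (outdeg F′ v + τ′ v ≡ indeg F′ v + σ′ v)) →
                Conserves F σ τ ⇔ Conserves F′ σ′ τ′
  conserves-⇔ pointwise = mk⇔ (λ (conserving c) → conserving (λ v → to (pointwise v) (c v)))
                              (λ (conserving c) → conserving (λ v → from (pointwise v) (c v)))

  conserves-shift : ∀ {F σ τ σ′ τ′} → (∀ v → σ v + τ′ v ≡ σ′ v + τ v) → Conserves F σ τ ⇔ Conserves F σ′ τ′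
  conserves-shift {F} {σ} {τ} {σ′} {τ′} same = conserves-⇔ (λ v → let x = outdeg F v ; y = indeg F v in
    mk⇔ (rebalance {x} {y} {σ v} {τ v} {σ′ v} {τ′ v} (same v)) (rebalance {x} {y} {σ′ v} {τ′ v} {σ v} {τ v} (sym (same v))))

  conserves-∅ : ∀ σ → Conserves ∅ σ σ
  conserves-∅ σ = conserving (λ v →
    cong (_+ σ v) (trans (∣∅∩q∣≡0 ⟦ (λ e → src G e ≟ v) ⟧) (sym (∣∅∩q∣≡0 ⟦ (λ e → tgt G e ≟ v) ⟧))))

  conserves-remove-edge : ∀ {F σ τ e} → e ∈ F →
                          Conserves F σ τ ⇔ Conserves (F - e) (σ ⊕ tgt G e) (τ ⊕ src G e)
  conserves-remove-edge {F} {e = e} e∈F = conserves-⇔ (λ v →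
    balance-move (outdeg (F - e) v) (δ (src G e) v) (indeg (F - e) v) (δ (tgt G e) v)
                 (outdeg-remove e∈F v) (indeg-remove e∈F v))

  conserves-remove-trail : ∀ {F σ τ a b} T → IsWalk G a b T → Unique T → All (_∈ F) T →
                           Conserves F σ τ ⇔ Conserves (F ∖ T) (σ ⊕ b) (τ ⊕ a)
  conserves-remove-trail {σ = σ} {τ} {a} [] refl _ _ =
    conserves-shift (λ v → sym (swap-inner (σ v) (δ a v) (τ v)))
  conserves-remove-trail {F} {σ} {τ} {a} {b} (e ∷ T) (refl , walk) (e∉T ∷ unique) (e∈F ∷ T⊆F) =
    conserves-shift (λ v → cancel (σ v) (τ v) (δ a v) (δ b v) (δ (tgt G e) v))
      ⇔-∘ (conserves-remove-trail T walk unique T⊆F-e ⇔-∘ conserves-remove-edge e∈F)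
    where
      T⊆F-e : All (_∈ F - e) T
      T⊆F-e = All.zipWith (λ (x∈F , e≢x) → x∈p∧x≢y⇒x∈p-y x∈F (e≢x ∘ sym)) (T⊆F , e∉T)
      cancel : ∀ σ τ a b c → σ + c + b + (τ + a) ≡ σ + b + (τ + a + c)
      cancel = solve-∀

  conserves-remove-cycle : ∀ {F σ τ a} T → IsWalk G a a T → Unique T → All (_∈ F) T →
                           Conserves F σ τ → Conserves (F ∖ T) σ τ
  conserves-remove-cycle {σ = σ} {τ} {a} T cycle unique T⊆F =
    to (conserves-shift (λ v → swap-inner (σ v) (δ a v) (τ v)) ⇔-∘ conserves-remove-trail T cycle unique T⊆F)

-- Flows between two fixed vertices s and t: decomposition into paths, and cuts.
module Flows (G : Digraph) (s t : Fin (nV G)) where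

  open Walks G
  open Conservation G

  private
    V = Fin (nV G)
    E = Fin (nE G)

  units : ℕ → V → Supply
  units m u v = m * δ u v

  conserves-remove-st-trail : ∀ {F m T} → IsWalk G s t T → Unique T → All (_∈ F) T →
    Conserves F (units (suc m) s) (units (suc m) t) ⇔ Conserves (F ∖ T) (units m s) (units m t)
  conserves-remove-st-trail {m = m} {T} walk unique T⊆F =
    conserves-shift (λ v → one-unit m (δ s v) (δ t v)) ⇔-∘ conserves-remove-trail T walk unique T⊆F
    where
      one-unit : ∀ m x y → x + m * x + y + m * y ≡ m * x + (y + m * y + x)
      one-unit = solve-∀

  surplus-leaves : ∀ {F σ τ a} → a ≢ t → (∀ v → v ≢ t → τ v ≡ 0) → Conserves F (σ ⊕ a) τ → 1 ≤ outdeg F a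
  surplus-leaves {F} {σ} {τ} {a} a≢t demand (conserving balance) = begin
    1                          ≡⟨ δ-refl a ⟨
    δ a a                      ≤⟨ m≤n+m (δ a a) (indeg F a + σ a) ⟩
    indeg F a + σ a + δ a a    ≡⟨ +-assoc (indeg F a) (σ a) (δ a a) ⟩
    indeg F a + (σ a + δ a a)  ≡⟨ balance a ⟨
    outdeg F a + τ a           ≡⟨ cong (outdeg F a +_) (demand a a≢t) ⟩
    outdeg F a + 0             ≡⟨ +-identityʳ (outdeg F a) ⟩
    outdeg F a                 ∎
    where open ≤-Reasoning

  extract-trail : ∀ n {F σ τ a} → ∣ F ∣ < n → (∀ v → v ≢ t → τ v ≡ 0) → Conserves F (σ ⊕ a) τ →
                  Σ (List E) λ T → IsWalk G a t T × Unique T × All (_∈ F) T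
  extract-trail (suc n) {F} {σ} {τ} {a} size demand c with a ≟ t
  ... | yes a≡t = [] , a≡t , [] , []
  ... | no a≢t with leaving-edge {F} {a} (surplus-leaves a≢t demand c)
  ...   | e , e∈F , refl =
    let T , walk , unique , T⊆F-e = extract-trail n smaller demand c′
    in e ∷ T , (refl , walk) , All.map (λ x∈F-e e≡x → ∖-∉ (e ∷ []) x∈F-e (here (sym e≡x))) T⊆F-e ∷ unique
             , e∈F ∷ All.map (p─q⊆p F ⁅ e ⁆) T⊆F-e
    where
      smaller : ∣ F - e ∣ < n
      smaller = ≤-trans (x∈p⇒∣p-x∣<∣p∣ e∈F) (≤-pred size)
      move : ∀ σ τ a c → σ + a + c + τ ≡ σ + c + (τ + a)
      move = solve-∀
      c′ : Conserves (F - e) (σ ⊕ tgt G e) τ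
      c′ = to (conserves-shift (λ v → move (σ v) (τ v) (δ (src G e) v) (δ (tgt G e) v)) ⇔-∘ conserves-remove-edge e∈F) c

  flow-extend : ∀ {k F T p} → IsPath G s t p → All (L._∈ T) p → All (_∈ F) T →
                IsFlow G s t k (F ∖ T) → IsFlow G s t (suc k) F
  flow-extend {k} {F} {T} {p} path p⊆T T⊆F (Q , Q-path , Q-in , Q-disjoint) = R , R-path , R-in , R-disjoint
    where
      R : Fin (suc k) → List E
      R zero = p
      R (suc i) = Q i
      R-path : ∀ i → IsPath G s t (R i)
      R-path zero = path
      R-path (suc i) = Q-path i
      R-in : ∀ i → All (_∈ F) (R i)
      R-in zero = All.map (All.lookup T⊆F) p⊆T
      R-in (suc i) = All.map (∖-⊆ T) (Q-in i)
      apart : ∀ i e → e L.∈ p → e L.∈ Q i → ⊥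
      apart i e e∈p e∈Qi = ∖-∉ T (All.lookup (Q-in i) e∈Qi) (All.lookup p⊆T e∈p)
      R-disjoint : ∀ i j → i ≢ j → ∀ e → e L.∈ R i → e L.∈ R j → ⊥
      R-disjoint zero zero i≢j = ⊥-elim (i≢j refl)
      R-disjoint zero (suc j) _ e e∈p e∈Qj = apart j e e∈p e∈Qj
      R-disjoint (suc i) zero _ e e∈Qi e∈p = apart i e e∈p e∈Qi
      R-disjoint (suc i) (suc j) i≢j = Q-disjoint i j (i≢j ∘ cong suc)

  decompose : ∀ k {F} → Conserves F (units k s) (units k t) → IsFlow G s t k F
  decompose zero _ = (λ ()) , (λ ()) , (λ ()) , λ ()
  decompose (suc k) {F} c =
    let T , walk , unique , T⊆F = extract-trail (suc ∣ F ∣) {F} {units k s} {units (suc k) t} {s} ≤-refl demand-at-t c-from-s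
        p , path , p⊆T = shortcut T walk
    in flow-extend path p⊆T T⊆F (decompose k (to (conserves-remove-st-trail {m = k} walk unique T⊆F) c))
    where
      demand-at-t : ∀ v → v ≢ t → units (suc k) t v ≡ 0
      demand-at-t v v≢t = trans (cong (suc k *_) (δ-≢ (v≢t ∘ sym))) (*-zeroʳ (suc k))
      c-from-s : Conserves F (units k s ⊕ s) (units (suc k) t)
      c-from-s = to (conserves-shift (λ v → cong (_+ units (suc k) t v) (+-comm (δ s v) (k * δ s v)))) c

  paths-conserve : ∀ m {F} (Q : Fin m → List E) → (∀ i → IsPath G s t (Q i)) → (∀ i → All (_∈ F) (Q i)) →
                   (∀ i j → i ≢ j → ∀ e → e L.∈ Q i → e L.∈ Q j → ⊥) → (∀ {e} → e ∈ F → ∃ λ i → e L.∈ Q i) →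
                   Conserves F (units m s) (units m t)
  paths-conserve zero {F} Q _ _ _ cover =
    subst (λ F → Conserves F (units 0 s) (units 0 t)) (sym F≡∅) (conserves-∅ (λ _ → 0))
    where
      F≡∅ : F ≡ ∅
      F≡∅ = Empty-unique (λ (e , e∈F) → ¬Fin0 (proj₁ (cover e∈F)))
  paths-conserve (suc m) {F} Q path inF disjoint cover =
    from (conserves-remove-st-trail {m = m} (proj₁ (path zero)) (path-edges-unique (path zero)) (inF zero))
         (paths-conserve m (Q ∘ suc) (path ∘ suc) rest-in (λ i j i≢j → disjoint (suc i) (suc j) (i≢j ∘ suc-injective)) rest-cover)
    where
      rest-in : ∀ i → All (_∈ F ∖ Q zero) (Q (suc i))
      rest-in i = All.tabulate (λ {e} e∈Qi →
        ∈-∖ (Q zero) (All.lookup (inF (suc i)) e∈Qi) (λ e∈Q₀ → disjoint zero (suc i) 0≢1+n e e∈Q₀ e∈Qi))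
      rest-cover : ∀ {e} → e ∈ F ∖ Q zero → ∃ λ i → e L.∈ Q (suc i)
      rest-cover {e} e∈ with cover (∖-⊆ (Q zero) e∈)
      ... | zero , e∈Q₀ = ⊥-elim (∖-∉ (Q zero) e∈ e∈Q₀)
      ... | suc i , e∈Qi = i , e∈Qi

  flow-mono : ∀ {k F F′} → F ⊆ F′ → IsFlow G s t k F → IsFlow G s t k F′
  flow-mono F⊆F′ (Q , path , inF , disjoint) = Q , path , (λ i → All.map F⊆F′ (inF i)) , disjoint

  flow-meets-cut : ∀ {m F C} → IsCut G s t C → IsFlow G s t m F → m ≤ ∣ C ∩ F ∣
  flow-meets-cut {F = F} {C} cut (Q , path , inF , disjoint) =
    card-lower (C ∩ F) hit hit-injective (λ i → x∈p∩q⁺ (hit∈C i , All.lookup (inF i) (hit∈Q i)))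
    where
      crossing : ∀ i → ∃ λ e → e L.∈ Q i × e ∈ C
      crossing i = L.find (cut (Q i) (path i))
      hit = λ i → proj₁ (crossing i)
      hit∈Q = λ i → proj₁ (proj₂ (crossing i))
      hit∈C = λ i → proj₂ (proj₂ (crossing i))
      hit-injective : Injective _≡_ _≡_ hit
      hit-injective {i} {j} same with i ≟ j
      ... | yes i≡j = i≡j
      ... | no i≢j = ⊥-elim (disjoint i j i≢j (hit j) (subst (L._∈ Q i) same (hit∈Q i)) (hit∈Q j))

module Boundary (G : Digraph) (S : Subset (nV G)) where

  open Walks G

  ∂ : Subset (nE G)
  ∂ = ⟦ (λ e → (src G e ∈? S) ×-dec ¬? (tgt G e ∈? S)) ⟧

  ∂⁺ : ∀ {e} → src G e ∈ S → tgt G e ∉ S → e ∈ ∂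
  ∂⁺ src∈S tgt∉S = ∈⟦⟧⁺ (λ e → (src G e ∈? S) ×-dec ¬? (tgt G e ∈? S)) (src∈S , tgt∉S)

  ∂⁻ : ∀ {e} → e ∈ ∂ → src G e ∈ S × tgt G e ∉ S
  ∂⁻ = ∈⟦⟧⁻ (λ e → (src G e ∈? S) ×-dec ¬? (tgt G e ∈? S))

  crossing : ∀ {x y} w → IsWalk G x y w → x ∈ S → y ∉ S → Any (_∈ ∂) w
  crossing [] refl x∈S x∉S = ⊥-elim (x∉S x∈S)
  crossing (e ∷ w) (refl , walk) src∈S y∉S with tgt G e ∈? S
  ... | yes tgt∈S = there (crossing w walk tgt∈S y∉S)
  ... | no tgt∉S = here (∂⁺ src∈S tgt∉S)

  boundary-cut : ∀ {s t} → s ∈ S → t ∉ S → IsCut G s t ∂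
  boundary-cut s∈S t∉S es (walk , _) = crossing es walk s∈S t∉S

  Closed : Set
  Closed = ∀ e → tgt G e ∈ S → src G e ∈ S

  stays-outside : Closed → ∀ {x y e} w → IsWalk G x y w → x ∉ S → e L.∈ w → src G e ∉ S
  stays-outside closed (e ∷ w) (refl , _) x∉S (here refl) = x∉S
  stays-outside closed (e ∷ w) (refl , walk) x∉S (there e′∈w) = stays-outside closed w walk (x∉S ∘ closed e) e′∈w

  crosses-once : Closed → ∀ {x y e₁ e₂} w → IsWalk G x y w → e₁ L.∈ w → e₂ L.∈ w → e₁ ∈ ∂ → e₂ ∈ ∂ → e₁ ≡ e₂
  crosses-once closed (e ∷ w) _ (here refl) (here refl) _ _ = refl
  crosses-once closed (e ∷ w) (_ , walk) (here refl) (there e₂∈w) e∈∂ e₂∈∂ =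
    ⊥-elim (stays-outside closed w walk (proj₂ (∂⁻ e∈∂)) e₂∈w (proj₁ (∂⁻ e₂∈∂)))
  crosses-once closed (e ∷ w) (_ , walk) (there e₁∈w) (here refl) e₁∈∂ e∈∂ =
    ⊥-elim (stays-outside closed w walk (proj₂ (∂⁻ e∈∂)) e₁∈w (proj₁ (∂⁻ e₁∈∂)))
  crosses-once closed (e ∷ w) (_ , walk) (there e₁∈w) (there e₂∈w) = crosses-once closed w walk e₁∈w e₂∈w

-- The structure of a digraph whose edge set is a minimal (k+1)-flow from s to t.
module MinimalFlow (G : Digraph) (s t : Fin (nV G)) (s≢t : s ≢ t) (k : ℕ)
                   (minimal : IsMinimalFlow G s t (suc k) ⊤) where

  open Walks G
  open Conservation G
  open Flows G s t
  open Boundary G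

  private
    V = Fin (nV G)
    E = Fin (nE G)
    K = suc k
    module DecE = DecL (_≟_ {nE G})

    flow : IsFlow G s t K ⊤
    flow = proj₁ minimal

    P : Fin K → List E
    P = proj₁ flow

    P-path : ∀ i → IsPath G s t (P i)
    P-path = proj₁ (proj₂ flow)

  -- Every edge lies on one of the paths: otherwise they form a (k+1)-flow in ⊤ - e.
  on-path : ∀ e → ∃ λ i → e L.∈ P i
  on-path e with any? (λ i → e DecE.∈? P i)
  ... | yes found = found
  ... | no absent = ⊥-elim (proj₂ minimal (⊤ - e) (x∈p⇒p-x⊂p ∈⊤) (P , P-path , avoid-e , proj₂ (proj₂ (proj₂ flow))))
    where
      avoid-e : ∀ i → All (_∈ ⊤ - e) (P i)
      avoid-e i = All.tabulate (λ {x} x∈Pi → x∈p∧x≢y⇒x∈p-y ∈⊤ (λ x≡e → absent (i , subst (L._∈ P i) x≡e x∈Pi)))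

  s-reaches : ∀ e → Reach s (src G e)
  s-reaches e = let i , e∈Pi = on-path e in proj₁ (walk-split (P i) (proj₁ (P-path i)) e∈Pi)

  reaches-t : ∀ e → Reach (tgt G e) t
  reaches-t e = let i , e∈Pi = on-path e in proj₂ (walk-split (P i) (proj₁ (P-path i)) e∈Pi)

  ⊤-conserves : Conserves ⊤ (units K s) (units K t)
  ⊤-conserves = paths-conserve K P P-path (proj₁ (proj₂ (proj₂ flow))) (proj₂ (proj₂ (proj₂ flow))) (λ {e} _ → on-path e)

  proper-subsets-deficient : ∀ F → F ⊂ ⊤ → ¬ Conserves F (units K s) (units K t)
  proper-subsets-deficient F F⊂⊤ c = proj₂ minimal F F⊂⊤ (decompose K c)

  -- The digraph is acyclic: deleting a cycle would leave a proper subset conserving k+1 units.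
  acyclic : ∀ e → ¬ Reach (tgt G e) (src G e)
  acyclic e (w , walk) =
    let p , path , _ = shortcut w walk
        cycle = e ∷ p
    in proper-subsets-deficient (⊤ ∖ cycle) ((λ _ → ∈⊤) , e , ∈⊤ , λ e∈ → ∖-∉ cycle e∈ (here refl))
         (conserves-remove-cycle cycle (refl , proj₁ path) (edge-path-unique path) (All.tabulate (λ _ → ∈⊤)) ⊤-conserves)

  walk-unique : ∀ {x y} w → IsWalk G x y w → Unique w
  walk-unique [] _ = []
  walk-unique (e ∷ w) (_ , walk) =
    All.tabulate (λ e′∈w e≡e′ → acyclic e (proj₁ (walk-split w walk (subst (L._∈ w) (sym e≡e′) e′∈w)))) ∷ walk-unique w walk

  no-edge-out-of-t : ∀ e → src G e ≢ t
  no-edge-out-of-t e src≡t = acyclic e (subst (Reach (tgt G e)) (sym src≡t) (reaches-t e))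

  t-reaches-only-t : ∀ {y} → Reach t y → t ≡ y
  t-reaches-only-t ([] , t≡y) = t≡y
  t-reaches-only-t (e ∷ _ , src≡t , _) = ⊥-elim (no-edge-out-of-t e src≡t)

  no-return-to-s : ∀ e → ¬ Reach (tgt G e) s
  no-return-to-s e back = acyclic e (reach-trans back (s-reaches e))

  cut-size : ∀ {C} → IsCut G s t C → K ≤ ∣ C ∣
  cut-size {C} cut = ≤-trans (flow-meets-cut cut flow) (∣p∩q∣≤∣p∣ C ⊤)

  boundary-size : ∀ S → Closed S → ∣ ∂ S ∣ ≤ K
  boundary-size S closed = card-upper (∂ S) (λ e _ → proj₁ (on-path e)) same-path
    where
      same-path : ∀ {x y} → x ∈ ∂ S → y ∈ ∂ S → proj₁ (on-path x) ≡ proj₁ (on-path y) → x ≡ y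
      same-path {x} {y} x∈∂ y∈∂ same =
        let i , x∈Pi = on-path x in
        crosses-once S closed (P i) (proj₁ (P-path i)) x∈Pi (subst (λ j → y L.∈ P j) (sym same) (proj₂ (on-path y))) x∈∂ y∈∂

  ancestors-min-cut : ∀ Y → s L.∈ Y → All (t ≢_) Y → IsMinCut G s t (∂ (ancestors Y))
  ancestors-min-cut Y s∈Y t∉Y =
    boundary-cut S (ancestors-⊇ Y s∈Y) t∉S , λ C C-cut → ≤-trans (boundary-size S (ancestors-closed Y)) (cut-size C-cut)
    where
      S = ancestors Y
      t∉S : t ∉ S
      t∉S t∈S = All¬⇒¬Any t∉Y (Any.map t-reaches-only-t (ancestors⁻ Y t∈S))

  -- (⇒) A minimum cut through two edges outside a k-flow E′ would contain k + 2 edges.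
  flow⇒cover : ∀ E′ → IsFlow G s t k E′ → VertexCover (ΓAdj G s t) E′
  flow⇒cover E′ k-flow d₁ d₂ (d₁≢d₂ , C , (C-cut , C-min) , d₁∈C , d₂∈C) with d₁ ∈? E′ | d₂ ∈? E′
  ... | yes d₁∈E′ | _ = inj₁ d₁∈E′
  ... | no _ | yes d₂∈E′ = inj₂ d₂∈E′
  ... | no d₁∉E′ | no d₂∉E′ = ⊥-elim (1+n≰n too-large)
    where
      S = ancestors (s ∷ [])
      C∩E′-avoids : C ∩ E′ ⊆ C - d₁ - d₂
      C∩E′-avoids x∈ = let x∈C , x∈E′ = x∈p∩q⁻ C E′ x∈ in
        x∈p∧x≢y⇒x∈p-y (x∈p∧x≢y⇒x∈p-y x∈C (λ x≡d₁ → d₁∉E′ (subst (_∈ E′) x≡d₁ x∈E′)))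
                      (λ x≡d₂ → d₂∉E′ (subst (_∈ E′) x≡d₂ x∈E′))
      too-large : suc K ≤ K
      too-large = begin
        suc (suc k)                ≤⟨ s≤s (s≤s (≤-trans (flow-meets-cut C-cut k-flow) (p⊆q⇒∣p∣≤∣q∣ C∩E′-avoids))) ⟩
        suc (suc ∣ C - d₁ - d₂ ∣)  ≤⟨ s≤s (x∈p⇒∣p-x∣<∣p∣ (x∈p∧x≢y⇒x∈p-y d₂∈C (d₁≢d₂ ∘ sym))) ⟩
        suc ∣ C - d₁ ∣             ≤⟨ x∈p⇒∣p-x∣<∣p∣ d₁∈C ⟩
        ∣ C ∣                      ≤⟨ C-min (∂ S) (proj₁ (ancestors-min-cut (s ∷ []) (here refl) ((s≢t ∘ sym) ∷ []))) ⟩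
        ∣ ∂ S ∣                    ≤⟨ boundary-size S (ancestors-closed (s ∷ [])) ⟩
        K                          ∎
        where open ≤-Reasoning

  Precedes : E → E → Set
  Precedes d₁ d₂ = Reach (tgt G d₁) (src G d₂)

  precedes-trans : ∀ {a b c} → Precedes a b → Precedes b c → Precedes a c
  precedes-trans {b = b} a≺b b≺c = reach-trans a≺b (reach-edge b b≺c)

  -- Two incomparable edges both leave the ancestors of s and their tails: they lie on a minimum cut.
  incomparable⇒adjacent : ∀ {d₁ d₂} → d₁ ≢ d₂ → ¬ Precedes d₁ d₂ → ¬ Precedes d₂ d₁ → ΓAdj G s t d₁ d₂
  incomparable⇒adjacent {d₁} {d₂} d₁≢d₂ ¬d₁≺d₂ ¬d₂≺d₁ =
    d₁≢d₂ , ∂ S , ancestors-min-cut Y (here refl) t∉Y ,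
    ∂⁺ S (ancestors-⊇ Y (there (here refl))) (d₁-escapes ∘ ancestors⁻ Y) ,
    ∂⁺ S (ancestors-⊇ Y (there (there (here refl)))) (d₂-escapes ∘ ancestors⁻ Y)
    where
      Y = s ∷ src G d₁ ∷ src G d₂ ∷ []
      S = ancestors Y
      t∉Y : All (t ≢_) Y
      t∉Y = (s≢t ∘ sym) ∷ (no-edge-out-of-t d₁ ∘ sym) ∷ (no-edge-out-of-t d₂ ∘ sym) ∷ []
      d₁-escapes : ¬ Any (Reach (tgt G d₁)) Y
      d₁-escapes (here back) = no-return-to-s d₁ back
      d₁-escapes (there (here cycle)) = acyclic d₁ cycle
      d₁-escapes (there (there (here d₁≺d₂))) = ¬d₁≺d₂ d₁≺d₂
      d₂-escapes : ¬ Any (Reach (tgt G d₂)) Y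
      d₂-escapes (here back) = no-return-to-s d₂ back
      d₂-escapes (there (here d₂≺d₁)) = ¬d₂≺d₁ d₂≺d₁
      d₂-escapes (there (there (here cycle))) = acyclic d₂ cycle

  Chain : List E → Set
  Chain J = ∀ {d₁ d₂} → d₁ L.∈ J → d₂ L.∈ J → d₁ ≢ d₂ → Precedes d₁ d₂ ⊎ Precedes d₂ d₁

  Least : E → List E → Set
  Least m J = ∀ {d} → d L.∈ J → d ≢ m → Precedes m d

  before-least : ∀ {d m J} → Precedes d m → Least m J → ∀ {d′} → d′ L.∈ J → Precedes d d′
  before-least {m = m} d≺m m-least {d′} d′∈J with d′ ≟ m
  ... | yes refl = d≺m
  ... | no d′≢m = precedes-trans d≺m (m-least d′∈J d′≢m)

  least : ∀ d J → Chain (d ∷ J) → Σ E λ m → m L.∈ d ∷ J × Least m (d ∷ J)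
  least d [] _ = d , here refl , λ { (here refl) d≢d → ⊥-elim (d≢d refl) }
  least d (d₂ ∷ J) chain with least d₂ J (λ d₁∈ d₂∈ → chain (there d₁∈) (there d₂∈))
  ... | m , m∈ , m-least with d ≟ m
  ...   | yes refl = d , here refl , λ { (here refl) d≢d → ⊥-elim (d≢d refl) ; (there d′∈) → m-least d′∈ }
  ...   | no d≢m with chain (here refl) (there m∈) d≢m
  ...     | inj₁ d≺m = d , here refl , λ { (here refl) d≢d → ⊥-elim (d≢d refl) ; (there d′∈) _ → before-least d≺m m-least d′∈ }
  ...     | inj₂ m≺d = m , there m∈ , λ { (here refl) _ → m≺d ; (there d′∈) → m-least d′∈ }

  -- From a vertex x reaching t and the tails of all edges of a chain J, some walk to t
  -- passes through every edge of J: go to the least edge, traverse it, and recurse.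
  walk-through : ∀ n x J → length J ≤ n → Chain J → (∀ {d} → d L.∈ J → Reach x (src G d)) → Reach x t →
                 Σ (List E) λ W → IsWalk G x t W × All (L._∈ W) J
  walk-through n x [] _ _ _ (W , walk) = W , walk , []
  walk-through (suc n) x (d ∷ J) size chain x-reaches _ =
    w ++ m ∷ W′ , walk-++ w to-m (refl , walk′) , All.tabulate on-W
    where
      m-least = least d J chain
      m = proj₁ m-least
      m∈ = proj₁ (proj₂ m-least)
      not-m : Decidable (λ d′ → ¬ d′ ≡ m)
      not-m d′ = ¬? (d′ ≟ m)
      J′ = filter not-m (d ∷ J)
      kept : ∀ {d′} → d′ L.∈ J′ → d′ L.∈ d ∷ J
      kept d′∈ = proj₁ (∈-filter⁻ not-m d′∈)
      smaller : length J′ ≤ n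
      smaller = ≤-pred (≤-trans (filter-notAll not-m (d ∷ J) (Any.map (λ m≡y y≢m → y≢m (sym m≡y)) m∈)) size)
      rest = walk-through n (tgt G m) J′ smaller (λ d₁∈ d₂∈ → chain (kept d₁∈) (kept d₂∈))
               (λ d′∈ → let d′∈J , d′≢m = ∈-filter⁻ not-m d′∈ in proj₂ (proj₂ m-least) d′∈J d′≢m) (reaches-t m)
      W′ = proj₁ rest
      walk′ = proj₁ (proj₂ rest)
      w = proj₁ (x-reaches m∈)
      to-m = proj₂ (x-reaches m∈)
      on-W : ∀ {d′} → d′ L.∈ d ∷ J → d′ L.∈ w ++ m ∷ W′
      on-W {d′} d′∈ with d′ ≟ m
      ... | yes refl = ∈-++⁺ʳ w (here refl)
      ... | no d′≢m = ∈-++⁺ʳ w (there (All.lookup (proj₂ (proj₂ rest)) (∈-filter⁺ not-m d′∈ d′≢m)))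

  -- (⇐) The edges outside a vertex cover E′ form a chain, so one s–t trail W passes
  -- through all of them; deleting W leaves a subset of E′ conserving k units.
  cover⇒flow : ∀ E′ → VertexCover (ΓAdj G s t) E′ → IsFlow G s t k E′
  cover⇒flow E′ cover =
    flow-mono remainder⊆E′ (decompose k (to (conserves-remove-st-trail {m = k} walk (walk-unique W walk) (All.tabulate (λ _ → ∈⊤))) ⊤-conserves))
    where
      not-in-E′ : Decidable (_∉ E′)
      not-in-E′ d = ¬? (d ∈? E′)
      J = filter not-in-E′ (allFin (nE G))
      excluded : ∀ {d} → d L.∈ J → d ∉ E′
      excluded d∈J = proj₂ (∈-filter⁻ not-in-E′ {xs = allFin (nE G)} d∈J)
      chain : Chain J
      chain {d₁} {d₂} d₁∈J d₂∈J d₁≢d₂ with reach? (tgt G d₁) (src G d₂) | reach? (tgt G d₂) (src G d₁)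
      ... | yes d₁≺d₂ | _ = inj₁ d₁≺d₂
      ... | no _ | yes d₂≺d₁ = inj₂ d₂≺d₁
      ... | no ¬d₁≺d₂ | no ¬d₂≺d₁ =
        ⊥-elim ([ excluded d₁∈J , excluded d₂∈J ]′ (cover d₁ d₂ (incomparable⇒adjacent d₁≢d₂ ¬d₁≺d₂ ¬d₂≺d₁)))
      through = walk-through (length J) s J ≤-refl chain (λ {d} _ → s-reaches d) (P zero , proj₁ (P-path zero))
      W = proj₁ through
      walk = proj₁ (proj₂ through)
      remainder⊆E′ : ⊤ ∖ W ⊆ E′
      remainder⊆E′ {d} d∈ with d ∈? E′
      ... | yes d∈E′ = d∈E′
      ... | no d∉E′ = ⊥-elim (∖-∉ W d∈ (All.lookup (proj₂ (proj₂ through)) (∈-filter⁺ not-in-E′ (∈-allFin d) d∉E′)))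

lemma4 : (H : Digraph) (s t : Fin (nV H)) → s ≢ t → (k : ℕ) →
         IsMinimalFlow H s t (suc k) ⊤ →
         (E' : Subset (nE H)) →
         (IsFlow H s t k E' → VertexCover (ΓAdj H s t) E') ×
         (VertexCover (ΓAdj H s t) E' → IsFlow H s t k E')
lemma4 H s t s≢t k minimal E′ = flow⇒cover E′ , cover⇒flow E′
  where open MinimalFlow H s t s≢t k minimal
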